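{- Let $n$ be a nonnegative integer, let $A_n=\sum_{k=0}^n\binom nk^2\binom{n+k}k^2$ and $\beta_n=\sum_{k=0}^{n}\binom{n}{k}^2\binom{n+k}{k}$. If $A_n\equiv 8j+4i+1\pmod{16}$ with $i,j\in\{0,1\}$, then $\beta_n\equiv 2(i+j)+1\pmod 4$. -}

module Defs where

open import Data.Nat using (ℕ; _+_; _*_; _^_)
open import Data.Nat.Combinatorics using (_C_)
open import Data.List using (map; upTo)
open import Data.Nat.ListAction using (sum)

A : ℕ → ℕ
A n = sum (map (λ k → ((n C k) ^ 2) * ((n + k) C k) ^ 2) (upTo (n + 1)))

β : ℕ → ℕ
β n = sum (map (λ k → ((n C k) ^ 2) * ((n + k) C k)) (upTo (n + 1)))

{-# OPTIONS --safe #-}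
module Submission where

open import Defs
open import Data.Nat
open import Data.Nat.Properties
open import Data.Nat.DivMod
open import Data.Nat.Divisibility using (divides)
open import Data.Nat.Combinatorics
  using (_C_; nCk+nC[k+1]≡[n+1]C[k+1]; nCk≡nC[n∸k]; nC1≡n; k>n⇒nCk≡0; nCk≡n!/k![n-k]!; k![n∸k]!∣n!)
open import Data.Nat.Induction using (<-rec)
open import Data.Nat.ListAction using (sum)
open import Data.Nat.Tactic.RingSolver using (solve-∀)
open import Data.List using (applyUpTo; map; upTo)
open import Data.List.Properties using (map-upTo)
open import Data.Product using (_×_; _,_; proj₂)
open import Function using (_∘_)
open import Relation.Binary.PropositionalEquality
open import Relation.Nullary using (yes; no)

-- With k = j + 1, the identities C(n,k) C(n+k,k) = C(n+k,2k) C(2k,k) and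
-- C(2k,k) = 2 C(2k-1,k-1) write the k-th summand of A_n as 4 c(n,j)^2 and that
-- of β_n as 2 C(n,j+1) c(n,j), where c(n,j) = C(2j+1,j) C(n+j+1,2j+2).  Hence
-- A_n ≡ 1 + 4 N_n (mod 16) and β_n ≡ 1 + 2 M_n (mod 4), where N_n and M_n count
-- the j < n for which c(n,j), resp. C(n,j+1) c(n,j), is odd.  By Lucas' theorem
-- mod 2, passing from m to 2m or 2m+1 kills the even j > 0 and maps j = 2l+1 to l,
-- so N and M obey simple recursions along binary expansions.  Binary induction
-- shows N_n ≡ n (mod 2) and that M_n is odd exactly when N_n ≡ 1, 2 (mod 4).
-- Reading N_n ≡ i + 2j (mod 4) off A_n finishes the proof.

-- Not 2 * n: the inductions below need double (suc n) to reduce to suc (suc (double n)).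
double : ℕ → ℕ
double zero    = zero
double (suc n) = suc (suc (double n))

double≡n+n : ∀ n → double n ≡ n + n
double≡n+n zero    = refl
double≡n+n (suc n) = cong suc (trans (cong suc (double≡n+n n)) (sym (+-suc n n)))

n+n≡n*2 : ∀ n → n + n ≡ n * 2
n+n≡n*2 n = trans (cong (n +_) (sym (+-identityʳ n))) (*-comm 2 n)

double≡n*2 : ∀ n → double n ≡ n * 2
double≡n*2 n = trans (double≡n+n n) (n+n≡n*2 n)

double-+ : ∀ m n → double (m + n) ≡ double m + double n
double-+ zero    n = refl
double-+ (suc m) n = cong (suc ∘ suc) (double-+ m n)

[e+2m]%2≡e%2 : ∀ e m → (e + double m) % 2 ≡ e % 2
[e+2m]%2≡e%2 e m = trans (cong (λ x → (e + x) % 2) (double≡n*2 m)) ([m+kn]%n≡m%n e m 2)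

binary-induction : (P : ℕ → Set) → P 0 →
                   (∀ {e} m → e ≤ 1 → P m → P (e + double m)) → ∀ n → P n
binary-induction P P0 step = <-rec P go
  where
  go : ∀ n → (∀ {m} → m < n → P m) → P n
  go zero      _  = P0
  go n@(suc _) ih = subst P (sym n≡bit+2half)
                      (step (n / 2) (≤-pred (m%n<n n 2)) (ih (m/n<m n 2 (s≤s (s≤s z≤n)))))
    where
    n≡bit+2half : n ≡ n % 2 + double (n / 2)
    n≡bit+2half = trans (m≡m%n+[m/n]*n n 2) (cong (n % 2 +_) (sym (double≡n*2 (n / 2))))

+-cong-% : ∀ d .{{_ : NonZero d}} {x x′ y y′} →
           x % d ≡ x′ % d → y % d ≡ y′ % d → (x + y) % d ≡ (x′ + y′) % d
+-cong-% d {x} {x′} {y} {y′} x≡x′ y≡y′ = begin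
  (x + y) % d               ≡⟨ %-distribˡ-+ x y d ⟩
  (x % d + y % d) % d       ≡⟨ cong₂ (λ u v → (u + v) % d) x≡x′ y≡y′ ⟩
  (x′ % d + y′ % d) % d     ≡⟨ %-distribˡ-+ x′ y′ d ⟨
  (x′ + y′) % d             ∎
  where open ≡-Reasoning

*-cong-% : ∀ d .{{_ : NonZero d}} {x x′ y y′} →
           x % d ≡ x′ % d → y % d ≡ y′ % d → (x * y) % d ≡ (x′ * y′) % d
*-cong-% d {x} {x′} {y} {y′} x≡x′ y≡y′ = begin
  (x * y) % d               ≡⟨ %-distribˡ-* x y d ⟩
  (x % d * (y % d)) % d     ≡⟨ cong₂ (λ u v → (u * v) % d) x≡x′ y≡y′ ⟩
  (x′ % d * (y′ % d)) % d   ≡⟨ %-distribˡ-* x′ y′ d ⟨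
  (x′ * y′) % d             ∎
  where open ≡-Reasoning

m*m%4≡m%2 : ∀ m → (m * m) % 4 ≡ m % 2
m*m%4≡m%2 m = begin
  (m * m) % 4                         ≡⟨ cong (λ x → (x * x) % 4) (m≡m%n+[m/n]*n m 2) ⟩
  ((r + q * 2) * (r + q * 2)) % 4     ≡⟨ cong (_% 4) (expand r q) ⟩
  (r * r + (q * r + q * q) * 4) % 4   ≡⟨ [m+kn]%n≡m%n (r * r) (q * r + q * q) 4 ⟩
  (r * r) % 4                         ≡⟨ bit² (m%n<n m 2) ⟩
  r                                   ∎
  where
  open ≡-Reasoning
  r = m % 2
  q = m / 2
  expand : ∀ r q → (r + q * 2) * (r + q * 2) ≡ r * r + (q * r + q * q) * 4
  expand = solve-∀
  bit² : ∀ {b} → b < 2 → (b * b) % 4 ≡ b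
  bit² (s≤s z≤n)       = refl
  bit² (s≤s (s≤s z≤n)) = refl

[m*d+1]%[d*d]≡m%d*d+1 : ∀ m d .{{_ : NonZero d}} .{{_ : NonZero (d * d)}} →
                        1 < d → (m * d + 1) % (d * d) ≡ m % d * d + 1
[m*d+1]%[d*d]≡m%d*d+1 m d 1<d =
  trans ([m*n+o]%[p*n]≡[m*n]%[p*n]+o m d 1<d) (cong (_+ 1) (sym (m%n*o≡m*o%[n*o] m d d)))

∑< : ℕ → (ℕ → ℕ) → ℕ
∑< n f = sum (applyUpTo f n)

syntax ∑< n (λ j → e) = ∑[ j < n ] e

∑-cong : ∀ n {f g : ℕ → ℕ} → (∀ j → f j ≡ g j) → ∑< n f ≡ ∑< n g
∑-cong zero    f≡g = refl
∑-cong (suc n) f≡g = cong₂ _+_ (f≡g 0) (∑-cong n (f≡g ∘ suc))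

∑-distribʳ-* : ∀ n (f : ℕ → ℕ) k → ∑[ j < n ] (f j * k) ≡ ∑< n f * k
∑-distribʳ-* zero    f k = refl
∑-distribʳ-* (suc n) f k = trans (cong (f 0 * k +_) (∑-distribʳ-* n (f ∘ suc) k))
                                 (sym (*-distribʳ-+ k (f 0) (∑< n (f ∘ suc))))

∑-cong-% : ∀ n d .{{_ : NonZero d}} {f g : ℕ → ℕ} →
           (∀ j → f j % d ≡ g j % d) → ∑< n f % d ≡ ∑< n g % d
∑-cong-% zero    d f≡g = refl
∑-cong-% (suc n) d f≡g = +-cong-% d (f≡g 0) (∑-cong-% n d (f≡g ∘ suc))

∑-vanishing-tail : ∀ {n N} {f : ℕ → ℕ} → n ≤ N →
                   (∀ {j} → n ≤ j → f j ≡ 0) → ∑< N f ≡ ∑< n f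
∑-vanishing-tail {zero}  {zero}      z≤n       f≡0 = refl
∑-vanishing-tail {zero}  {suc N} {f} z≤n       f≡0 =
  cong₂ _+_ (f≡0 z≤n) (∑-vanishing-tail {N = N} {f ∘ suc} z≤n (λ _ → f≡0 z≤n))
∑-vanishing-tail {suc n} {suc N} {f} (s≤s n≤N) f≡0 =
  cong (f 0 +_) (∑-vanishing-tail n≤N (f≡0 ∘ s≤s))

∑-pairs : ∀ m (f : ℕ → ℕ) → ∑< (double m) f ≡ ∑[ l < m ] (f (double l) + f (suc (double l)))
∑-pairs zero    f = refl
∑-pairs (suc m) f = trans (sym (+-assoc (f 0) (f 1) _))
                          (cong (f 0 + f 1 +_) (∑-pairs m (f ∘ suc ∘ suc)))

sum-upTo-suc : ∀ (f : ℕ → ℕ) n → sum (map f (upTo (n + 1))) ≡ f 0 + ∑< n (f ∘ suc)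
sum-upTo-suc f n = trans (cong sum (map-upTo f (n + 1))) (cong (λ k → ∑< k f) (+-comm n 1))

pascal-%2 : ∀ n k x y → (n C k) % 2 ≡ x % 2 → (n C suc k) % 2 ≡ y % 2 →
            (suc n C suc k) % 2 ≡ (x + y) % 2
pascal-%2 n k x y nCk≡x nC[k+1]≡y = trans (cong (_% 2) (sym (nCk+nC[k+1]≡[n+1]C[k+1] n k)))
                                          (+-cong-% 2 {n C k} {x} {n C suc k} {y} nCk≡x nC[k+1]≡y)

mutual
  [2a]C[2b]%2≡aCb%2 : ∀ a b → (double a C double b) % 2 ≡ (a C b) % 2
  [2a]C[2b]%2≡aCb%2 zero    zero    = refl
  [2a]C[2b]%2≡aCb%2 zero    (suc b) = refl
  [2a]C[2b]%2≡aCb%2 (suc a) zero    = refl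
  [2a]C[2b]%2≡aCb%2 (suc a) (suc b) =
    trans (pascal-%2 (suc (double a)) (suc (double b)) (a C b) (a C suc b)
                     ([2a+1]C[2b+1]%2≡aCb%2 a b) ([2a+1]C[2b]%2≡aCb%2 a (suc b)))
          (cong (_% 2) (nCk+nC[k+1]≡[n+1]C[k+1] a b))

  [2a]C[2b+1]%2≡0 : ∀ a b → (double a C suc (double b)) % 2 ≡ 0
  [2a]C[2b+1]%2≡0 zero    b = refl
  [2a]C[2b+1]%2≡0 (suc a) b =
    trans (pascal-%2 (suc (double a)) (double b) (a C b) (a C b)
                     ([2a+1]C[2b]%2≡aCb%2 a b) ([2a+1]C[2b+1]%2≡aCb%2 a b))
          (trans (cong (_% 2) (n+n≡n*2 (a C b))) (m*n%n≡0 (a C b) 2))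

  [2a+1]C[2b]%2≡aCb%2 : ∀ a b → (suc (double a) C double b) % 2 ≡ (a C b) % 2
  [2a+1]C[2b]%2≡aCb%2 a zero    = refl
  [2a+1]C[2b]%2≡aCb%2 a (suc b) =
    pascal-%2 (double a) (suc (double b)) 0 (a C suc b)
              ([2a]C[2b+1]%2≡0 a b) ([2a]C[2b]%2≡aCb%2 a (suc b))

  [2a+1]C[2b+1]%2≡aCb%2 : ∀ a b → (suc (double a) C suc (double b)) % 2 ≡ (a C b) % 2
  [2a+1]C[2b+1]%2≡aCb%2 a b =
    trans (pascal-%2 (double a) (double b) (a C b) 0 ([2a]C[2b]%2≡aCb%2 a b) ([2a]C[2b+1]%2≡0 a b))
          (cong (_% 2) (+-identityʳ (a C b)))

[e+2a]C[2b]%2≡aCb%2 : ∀ {e} → e ≤ 1 → ∀ a b → ((e + double a) C double b) % 2 ≡ (a C b) % 2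
[e+2a]C[2b]%2≡aCb%2 z≤n       = [2a]C[2b]%2≡aCb%2
[e+2a]C[2b]%2≡aCb%2 (s≤s z≤n) = [2a+1]C[2b]%2≡aCb%2

[2k+2]C[k+1]≡2*[2k+1]Ck : ∀ k → double (suc k) C suc k ≡ 2 * (suc (double k) C k)
[2k+2]C[k+1]≡2*[2k+1]Ck k = begin
  suc (suc (double k)) C suc k                   ≡⟨ nCk+nC[k+1]≡[n+1]C[k+1] n k ⟨
  n C k + n C suc k                              ≡⟨ cong (n C k +_) symmetry ⟩
  n C k + n C k                                  ≡⟨ cong (n C k +_) (+-identityʳ (n C k)) ⟨
  2 * (n C k)                                    ∎
  where
  open ≡-Reasoning
  n = suc (double k)
  n∸[k+1]≡k : n ∸ suc k ≡ k
  n∸[k+1]≡k = trans (cong (_∸ k) (double≡n+n k)) (m+n∸n≡m k k)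
  symmetry : n C suc k ≡ n C k
  symmetry = trans (nCk≡nC[n∸k] (s≤s (subst (k ≤_) (sym (double≡n+n k)) (m≤m+n k k))))
                   (cong (n C_) n∸[k+1]≡k)

[m+n]Cm*[m!*n!]≡[m+n]! : ∀ m n → ((m + n) C m) * (m ! * n !) ≡ (m + n) !
[m+n]Cm*[m!*n!]≡[m+n]! m n = begin
  ((m + n) C m) * (m ! * n !)
    ≡⟨ cong (λ x → ((m + n) C m) * (m ! * x !)) (m+n∸m≡n m n) ⟨
  ((m + n) C m) * (m ! * (m + n ∸ m) !)
    ≡⟨ cong (_* (m ! * (m + n ∸ m) !)) (nCk≡n!/k![n-k]! (m≤m+n m n)) ⟩
  ((m + n) ! / (m ! * (m + n ∸ m) !)) * (m ! * (m + n ∸ m) !)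
    ≡⟨ m/n*n≡m (k![n∸k]!∣n! (m≤m+n m n)) ⟩
  (m + n) ! ∎
  where
  open ≡-Reasoning
  instance _ = m !* (m + n ∸ m) !≢0

[a+b+c]C[a+b]*[a+b]Ca≡[a+b+c]Ca*[b+c]Cb : ∀ a b c →
  ((a + b + c) C (a + b)) * ((a + b) C a) ≡ ((a + b + c) C a) * ((b + c) C b)
[a+b+c]C[a+b]*[a+b]Ca≡[a+b+c]Ca*[b+c]Cb a b c =
  *-cancelʳ-≡ _ _ (a ! * b ! * c !) (trans lhs (sym rhs))
  where
  open ≡-Reasoning
  instance _ = m*n≢0 (a ! * b !) (c !) {{a !* b !≢0}} {{c !≢0}}
  regroupˡ : ∀ x y p q r → x * y * (p * q * r) ≡ x * (y * (p * q) * r)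
  regroupˡ = solve-∀
  regroupʳ : ∀ x y p q r → x * y * (p * q * r) ≡ x * (p * (y * (q * r)))
  regroupʳ = solve-∀
  lhs : ((a + b + c) C (a + b)) * ((a + b) C a) * (a ! * b ! * c !) ≡ (a + b + c) !
  lhs = begin
    _ ≡⟨ regroupˡ ((a + b + c) C (a + b)) ((a + b) C a) (a !) (b !) (c !) ⟩
    ((a + b + c) C (a + b)) * (((a + b) C a) * (a ! * b !) * c !)
      ≡⟨ cong (λ x → ((a + b + c) C (a + b)) * (x * c !)) ([m+n]Cm*[m!*n!]≡[m+n]! a b) ⟩
    ((a + b + c) C (a + b)) * ((a + b) ! * c !)
      ≡⟨ [m+n]Cm*[m!*n!]≡[m+n]! (a + b) c ⟩
    (a + b + c) ! ∎
  rhs : ((a + b + c) C a) * ((b + c) C b) * (a ! * b ! * c !) ≡ (a + b + c) !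
  rhs = begin
    _ ≡⟨ regroupʳ ((a + b + c) C a) ((b + c) C b) (a !) (b !) (c !) ⟩
    ((a + b + c) C a) * (a ! * (((b + c) C b) * (b ! * c !)))
      ≡⟨ cong (λ x → ((a + b + c) C a) * (a ! * x)) ([m+n]Cm*[m!*n!]≡[m+n]! b c) ⟩
    ((a + b + c) C a) * (a ! * (b + c) !)
      ≡⟨ cong (λ x → (x C a) * (a ! * (b + c) !)) (+-assoc a b c) ⟩
    ((a + (b + c)) C a) * (a ! * (b + c) !)
      ≡⟨ [m+n]Cm*[m!*n!]≡[m+n]! a (b + c) ⟩
    (a + (b + c)) !
      ≡⟨ cong _! (+-assoc a b c) ⟨
    (a + b + c) ! ∎

halfTerm : ℕ → ℕ → ℕ
halfTerm n j = (suc (double j) C j) * ((n + suc j) C double (suc j))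

halfTerm-vanishes : ∀ {n j} → n ≤ j → halfTerm n j ≡ 0
halfTerm-vanishes {n} {j} n≤j =
  trans (cong ((suc (double j) C j) *_) (k>n⇒nCk≡0 n+j+1<2j+2)) (*-zeroʳ (suc (double j) C j))
  where
  n+j+1<2j+2 : n + suc j < double (suc j)
  n+j+1<2j+2 = subst (n + suc j <_) (sym (double≡n+n (suc j))) (+-monoˡ-< (suc j) (s≤s n≤j))

nC[j+1]*[n+j+1]C[j+1]≡2*halfTerm : ∀ n j →
  (n C suc j) * ((n + suc j) C suc j) ≡ 2 * halfTerm n j
nC[j+1]*[n+j+1]C[j+1]≡2*halfTerm n j with suc j ≤? n
... | no  j+1≰n = trans (cong (_* ((n + suc j) C suc j)) (k>n⇒nCk≡0 (≰⇒> j+1≰n)))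
                        (cong (2 *_) (sym (halfTerm-vanishes (≤-pred (≰⇒> j+1≰n)))))
... | yes j+1≤n with m≤n⇒∃[o]m+o≡n j+1≤n
...   | o , refl = begin
  ((k + o) C k) * ((k + o + k) C k)
    ≡⟨ *-comm ((k + o) C k) _ ⟩
  ((k + o + k) C k) * ((k + o) C k)
    ≡⟨ cong (λ x → (x C k) * ((k + o) C k)) k+o+k≡k+k+o ⟩
  ((k + k + o) C k) * ((k + o) C k)
    ≡⟨ [a+b+c]C[a+b]*[a+b]Ca≡[a+b+c]Ca*[b+c]Cb k k o ⟨
  ((k + k + o) C (k + k)) * ((k + k) C k)
    ≡⟨ cong₂ (λ x y → (x C y) * (y C k)) (sym k+o+k≡k+k+o) (sym (double≡n+n k)) ⟩
  ((k + o + k) C double k) * (double k C k)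
    ≡⟨ cong (((k + o + k) C double k) *_) ([2k+2]C[k+1]≡2*[2k+1]Ck j) ⟩
  ((k + o + k) C double k) * (2 * (suc (double j) C j))
    ≡⟨ regroup ((k + o + k) C double k) (suc (double j) C j) ⟩
  2 * halfTerm (k + o) j ∎
  where
  open ≡-Reasoning
  k = suc j
  k+o+k≡k+k+o : k + o + k ≡ k + k + o
  k+o+k≡k+k+o = trans (+-assoc k o k) (trans (cong (k +_) (+-comm o k)) (sym (+-assoc k k o)))
  regroup : ∀ x y → x * (2 * y) ≡ 2 * (y * x)
  regroup = solve-∀

A≡∑halfTerm²*4+1 : ∀ n → A n ≡ (∑[ j < n ] (halfTerm n j * halfTerm n j)) * 4 + 1
A≡∑halfTerm²*4+1 n = begin
  A n
    ≡⟨ sum-upTo-suc _ n ⟩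
  1 + ∑[ j < n ] ((n C suc j) ^ 2 * ((n + suc j) C suc j) ^ 2)
    ≡⟨ cong (1 +_) (∑-cong n summand) ⟩
  1 + ∑[ j < n ] (halfTerm n j * halfTerm n j * 4)
    ≡⟨ cong (1 +_) (∑-distribʳ-* n (λ j → halfTerm n j * halfTerm n j) 4) ⟩
  1 + (∑[ j < n ] (halfTerm n j * halfTerm n j)) * 4
    ≡⟨ +-comm 1 _ ⟩
  (∑[ j < n ] (halfTerm n j * halfTerm n j)) * 4 + 1 ∎
  where
  open ≡-Reasoning
  square-product : ∀ x y → x * (x * 1) * (y * (y * 1)) ≡ (x * y) * (x * y)
  square-product = solve-∀
  square-double : ∀ h → (2 * h) * (2 * h) ≡ h * h * 4
  square-double = solve-∀
  summand : ∀ j → (n C suc j) ^ 2 * ((n + suc j) C suc j) ^ 2 ≡ halfTerm n j * halfTerm n j * 4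
  summand j = begin
    _       ≡⟨ square-product (n C suc j) ((n + suc j) C suc j) ⟩
    _       ≡⟨ cong (λ x → x * x) (nC[j+1]*[n+j+1]C[j+1]≡2*halfTerm n j) ⟩
    _       ≡⟨ square-double (halfTerm n j) ⟩
    _       ∎

βHalfTerm : ℕ → ℕ → ℕ
βHalfTerm n j = (n C suc j) * halfTerm n j

β≡∑βHalfTerm*2+1 : ∀ n → β n ≡ (∑[ j < n ] βHalfTerm n j) * 2 + 1
β≡∑βHalfTerm*2+1 n = begin
  β n                                          ≡⟨ sum-upTo-suc _ n ⟩
  1 + ∑[ j < n ] ((n C suc j) ^ 2 * ((n + suc j) C suc j))
      ≡⟨ cong (1 +_) (∑-cong n summand) ⟩
  1 + ∑[ j < n ] (βHalfTerm n j * 2)           ≡⟨ cong (1 +_) (∑-distribʳ-* n (βHalfTerm n) 2) ⟩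
  1 + (∑[ j < n ] βHalfTerm n j) * 2           ≡⟨ +-comm 1 _ ⟩
  (∑[ j < n ] βHalfTerm n j) * 2 + 1           ∎
  where
  open ≡-Reasoning
  regroup : ∀ x y → x * (x * 1) * y ≡ x * (x * y)
  regroup = solve-∀
  regroup′ : ∀ x h → x * (2 * h) ≡ x * h * 2
  regroup′ = solve-∀
  summand : ∀ j → (n C suc j) ^ 2 * ((n + suc j) C suc j) ≡ βHalfTerm n j * 2
  summand j = begin
    _       ≡⟨ regroup (n C suc j) ((n + suc j) C suc j) ⟩
    _       ≡⟨ cong ((n C suc j) *_) (nC[j+1]*[n+j+1]C[j+1]≡2*halfTerm n j) ⟩
    _       ≡⟨ regroup′ (n C suc j) (halfTerm n j) ⟩
    _       ∎

oddCount : (ℕ → ℕ → ℕ) → ℕ → ℕ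
oddCount t n = ∑[ j < n ] (t n j % 2)

A%16≡oddCount%4*4+1 : ∀ n → A n % 16 ≡ oddCount halfTerm n % 4 * 4 + 1
A%16≡oddCount%4*4+1 n = begin
  A n % 16                       ≡⟨ cong (_% 16) (A≡∑halfTerm²*4+1 n) ⟩
  (S * 4 + 1) % 16               ≡⟨ [m*d+1]%[d*d]≡m%d*d+1 S 4 (s≤s (s≤s z≤n)) ⟩
  S % 4 * 4 + 1                  ≡⟨ cong (λ x → x * 4 + 1) (∑-cong-% n 4 square%4≡parity%4) ⟩
  oddCount halfTerm n % 4 * 4 + 1 ∎
  where
  open ≡-Reasoning
  S = ∑[ j < n ] (halfTerm n j * halfTerm n j)
  square%4≡parity%4 : ∀ j → (halfTerm n j * halfTerm n j) % 4 ≡ (halfTerm n j % 2) % 4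
  square%4≡parity%4 j = trans (m*m%4≡m%2 (halfTerm n j))
    (sym (m<n⇒m%n≡m (<-trans (m%n<n (halfTerm n j) 2) (s≤s (s≤s (s≤s z≤n))))))

β%4≡oddCount%2*2+1 : ∀ n → β n % 4 ≡ oddCount βHalfTerm n % 2 * 2 + 1
β%4≡oddCount%2*2+1 n = begin
  β n % 4                         ≡⟨ cong (_% 4) (β≡∑βHalfTerm*2+1 n) ⟩
  (S * 2 + 1) % 4                 ≡⟨ [m*d+1]%[d*d]≡m%d*d+1 S 2 (s≤s (s≤s z≤n)) ⟩
  S % 2 * 2 + 1                   ≡⟨ cong (λ x → x * 2 + 1) (∑-cong-% n 2 parity%2) ⟩
  oddCount βHalfTerm n % 2 * 2 + 1 ∎
  where
  open ≡-Reasoning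
  S = ∑[ j < n ] βHalfTerm n j
  parity%2 : ∀ j → βHalfTerm n j % 2 ≡ (βHalfTerm n j % 2) % 2
  parity%2 j = sym (m%n%n≡m%n (βHalfTerm n j) 2)

oddCount-[e+2m] : ∀ (t : ℕ → ℕ → ℕ) {e} m → e ≤ 1 →
  (∀ {n j} → n ≤ j → t n j ≡ 0) →
  (∀ l → t (e + double m) (suc (double l)) % 2 ≡ t m l % 2) →
  (∀ l → t (e + double m) (double (suc l)) % 2 ≡ 0) →
  oddCount t (e + double m) ≡ t (e + double m) 0 % 2 + oddCount t m
oddCount-[e+2m] t {e} m e≤1 vanishes odd even = begin
  oddCount t n
    ≡⟨ ∑-vanishing-tail n≤2m+2 (cong (_% 2) ∘ vanishes) ⟨
  ∑[ j < double (suc m) ] tₙ j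
    ≡⟨ ∑-pairs (suc m) tₙ ⟩
  (tₙ 0 + tₙ 1) + ∑[ l < m ] (tₙ (double (suc l)) + tₙ (suc (double (suc l))))
    ≡⟨ cong₂ _+_ (cong (tₙ 0 +_) (odd 0)) (∑-cong m (λ l → cong₂ _+_ (even l) (odd (suc l)))) ⟩
  (tₙ 0 + t m 0 % 2) + ∑[ l < m ] (t m (suc l) % 2)
    ≡⟨ +-assoc (tₙ 0) _ _ ⟩
  tₙ 0 + ∑[ j < suc m ] (t m j % 2)
    ≡⟨ cong (tₙ 0 +_) (∑-vanishing-tail (n≤1+n m) (cong (_% 2) ∘ vanishes)) ⟩
  tₙ 0 + oddCount t m ∎
  where
  open ≡-Reasoning
  n = e + double m
  tₙ : ℕ → ℕ
  tₙ j = t n j % 2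
  n≤2m+2 : n ≤ double (suc m)
  n≤2m+2 = ≤-trans (+-monoˡ-≤ (double m) e≤1) (n≤1+n (suc (double m)))

halfTerm-[e+2m]-0 : ∀ {e} m → e ≤ 1 → halfTerm (e + double m) 0 % 2 ≡ (e + m) % 2
halfTerm-[e+2m]-0 m z≤n = begin
  halfTerm (double m) 0 % 2       ≡⟨ cong (_% 2) (+-identityʳ ((double m + 1) C 2)) ⟩
  ((double m + 1) C 2) % 2        ≡⟨ cong (λ x → (x C 2) % 2) (+-comm (double m) 1) ⟩
  (suc (double m) C 2) % 2        ≡⟨ [2a+1]C[2b]%2≡aCb%2 m 1 ⟩
  (m C 1) % 2                     ≡⟨ cong (_% 2) (nC1≡n m) ⟩
  m % 2                           ∎
  where open ≡-Reasoning
halfTerm-[e+2m]-0 m (s≤s z≤n) = begin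
  halfTerm (suc (double m)) 0 % 2 ≡⟨ cong (_% 2) (+-identityʳ ((suc (double m) + 1) C 2)) ⟩
  ((suc (double m) + 1) C 2) % 2  ≡⟨ cong (λ x → (x C 2) % 2) (+-comm (suc (double m)) 1) ⟩
  (double (suc m) C 2) % 2        ≡⟨ [2a]C[2b]%2≡aCb%2 (suc m) 1 ⟩
  (suc m C 1) % 2                 ≡⟨ cong (_% 2) (nC1≡n (suc m)) ⟩
  suc m % 2                       ∎
  where open ≡-Reasoning

halfTerm-[e+2m]-odd : ∀ {e} m → e ≤ 1 → ∀ l →
                      halfTerm (e + double m) (suc (double l)) % 2 ≡ halfTerm m l % 2
halfTerm-[e+2m]-odd {e} m e≤1 l =
  *-cong-% 2 {suc (double j) C j} {suc (double l) C l}
             {(n + suc j) C double (suc j)} {(m + suc l) C double (suc l)}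
    ([2a+1]C[2b+1]%2≡aCb%2 j l)
    (trans (cong (λ x → (x C double (suc j)) % 2) n+j+1≡e+2[m+l+1])
           ([e+2a]C[2b]%2≡aCb%2 e≤1 (m + suc l) (double (suc l))))
  where
  n = e + double m
  j = suc (double l)
  n+j+1≡e+2[m+l+1] : n + suc j ≡ e + double (m + suc l)
  n+j+1≡e+2[m+l+1] = trans (+-assoc e (double m) _) (cong (e +_) (sym (double-+ m (suc l))))

halfTerm-even : ∀ n l → halfTerm n (double (suc l)) % 2 ≡ 0
halfTerm-even n l = *-cong-% 2 {suc (double j) C j} {0} {Y} {Y} [2j+1]Cj%2≡0 refl
  where
  open ≡-Reasoning
  j = double (suc l)
  Y = (n + suc j) C double (suc j)
  [2j+1]Cj%2≡0 : (suc (double j) C j) % 2 ≡ 0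
  [2j+1]Cj%2≡0 = begin
    (suc (double j) C j) % 2             ≡⟨ [2a+1]C[2b]%2≡aCb%2 j (suc l) ⟩
    (j C suc l) % 2                      ≡⟨ cong (_% 2) ([2k+2]C[k+1]≡2*[2k+1]Ck l) ⟩
    (2 * (suc (double l) C l)) % 2       ≡⟨ cong (_% 2) (*-comm 2 (suc (double l) C l)) ⟩
    ((suc (double l) C l) * 2) % 2       ≡⟨ m*n%n≡0 (suc (double l) C l) 2 ⟩
    0                                    ∎

βHalfTerm-vanishes : ∀ {n j} → n ≤ j → βHalfTerm n j ≡ 0
βHalfTerm-vanishes {n} {j} n≤j =
  trans (cong ((n C suc j) *_) (halfTerm-vanishes n≤j)) (*-zeroʳ (n C suc j))

βHalfTerm-[e+2m]-0 : ∀ {e} m → e ≤ 1 → βHalfTerm (e + double m) 0 % 2 ≡ (e * (e + m)) % 2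
βHalfTerm-[e+2m]-0 {e} m e≤1 = *-cong-% 2 {n C 1} {e} {halfTerm n 0} {e + m}
  (trans (cong (_% 2) (nC1≡n n)) ([e+2m]%2≡e%2 e m)) (halfTerm-[e+2m]-0 m e≤1)
  where n = e + double m

βHalfTerm-[e+2m]-odd : ∀ {e} m → e ≤ 1 → ∀ l →
                       βHalfTerm (e + double m) (suc (double l)) % 2 ≡ βHalfTerm m l % 2
βHalfTerm-[e+2m]-odd {e} m e≤1 l =
  *-cong-% 2 {n C suc j} {m C suc l} {halfTerm n j} {halfTerm m l}
  ([e+2a]C[2b]%2≡aCb%2 e≤1 m (suc l)) (halfTerm-[e+2m]-odd m e≤1 l)
  where
  n = e + double m
  j = suc (double l)

βHalfTerm-even : ∀ n l → βHalfTerm n (double (suc l)) % 2 ≡ 0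
βHalfTerm-even n l =
  trans (*-cong-% 2 {n C suc j} {n C suc j} {halfTerm n j} {0} refl (halfTerm-even n l))
        (cong (_% 2) (*-zeroʳ (n C suc j)))
  where j = double (suc l)

isOneOrTwo : ℕ → ℕ
isOneOrTwo 1 = 1
isOneOrTwo 2 = 1
isOneOrTwo _ = 0

parity-step : ∀ {e r} → e ≤ 1 → r < 4 → ((e + r) % 2 + r) % 2 ≡ e % 2
parity-step z≤n       (s≤s z≤n)                   = refl
parity-step z≤n       (s≤s (s≤s z≤n))             = refl
parity-step z≤n       (s≤s (s≤s (s≤s z≤n)))       = refl
parity-step z≤n       (s≤s (s≤s (s≤s (s≤s z≤n)))) = refl
parity-step (s≤s z≤n) (s≤s z≤n)                   = refl
parity-step (s≤s z≤n) (s≤s (s≤s z≤n))             = refl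
parity-step (s≤s z≤n) (s≤s (s≤s (s≤s z≤n)))       = refl
parity-step (s≤s z≤n) (s≤s (s≤s (s≤s (s≤s z≤n)))) = refl

isOneOrTwo-step : ∀ {e r} → e ≤ 1 → r < 4 →
                  (e * ((e + r) % 2) + isOneOrTwo r) % 2 ≡ isOneOrTwo (((e + r) % 2 + r) % 4)
isOneOrTwo-step z≤n       (s≤s z≤n)                   = refl
isOneOrTwo-step z≤n       (s≤s (s≤s z≤n))             = refl
isOneOrTwo-step z≤n       (s≤s (s≤s (s≤s z≤n)))       = refl
isOneOrTwo-step z≤n       (s≤s (s≤s (s≤s (s≤s z≤n)))) = refl
isOneOrTwo-step (s≤s z≤n) (s≤s z≤n)                   = refl
isOneOrTwo-step (s≤s z≤n) (s≤s (s≤s z≤n))             = refl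
isOneOrTwo-step (s≤s z≤n) (s≤s (s≤s (s≤s z≤n)))       = refl
isOneOrTwo-step (s≤s z≤n) (s≤s (s≤s (s≤s (s≤s z≤n)))) = refl

OddCountInvariant : ℕ → Set
OddCountInvariant n = (oddCount halfTerm n % 2 ≡ n % 2)
                    × (oddCount βHalfTerm n % 2 ≡ isOneOrTwo (oddCount halfTerm n % 4))

oddCountInvariant-[e+2m] : ∀ {e} m → e ≤ 1 →
                           OddCountInvariant m → OddCountInvariant (e + double m)
oddCountInvariant-[e+2m] {e} m e≤1 (Nₘ%2≡m%2 , Mₘ%2≡χ[Nₘ%4]) = Nₙ%2≡n%2 , Mₙ%2≡χ[Nₙ%4]
  where
  open ≡-Reasoning
  n = e + double m
  N M : ℕ → ℕ
  N = oddCount halfTerm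
  M = oddCount βHalfTerm
  r = N m % 4
  d = (e + r) % 2
  Nₘ%2≡r%2 : N m % 2 ≡ r % 2
  Nₘ%2≡r%2 = sym (m∣n⇒o%n%m≡o%m 2 4 (N m) (divides 2 refl))
  [e+m]%2≡d : (e + m) % 2 ≡ d
  [e+m]%2≡d = +-cong-% 2 {e} {e} {m} {r} refl (trans (sym Nₘ%2≡m%2) Nₘ%2≡r%2)
  Nₙ≡d+Nₘ : N n ≡ d + N m
  Nₙ≡d+Nₘ = trans (oddCount-[e+2m] halfTerm m e≤1 halfTerm-vanishes
                                   (halfTerm-[e+2m]-odd m e≤1) (halfTerm-even n))
                  (cong (_+ N m) (trans (halfTerm-[e+2m]-0 m e≤1) [e+m]%2≡d))
  Mₙ≡[e*[e+m]]%2+Mₘ : M n ≡ (e * (e + m)) % 2 + M m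
  Mₙ≡[e*[e+m]]%2+Mₘ = trans (oddCount-[e+2m] βHalfTerm m e≤1 βHalfTerm-vanishes
                                             (βHalfTerm-[e+2m]-odd m e≤1) (βHalfTerm-even n))
                            (cong (_+ M m) (βHalfTerm-[e+2m]-0 m e≤1))
  [e*[e+m]]%2%2≡[e*d]%2 : (e * (e + m)) % 2 % 2 ≡ (e * d) % 2
  [e*[e+m]]%2%2≡[e*d]%2 =
    trans (m%n%n≡m%n (e * (e + m)) 2)
          (*-cong-% 2 {e} {e} {e + m} {d} refl (trans [e+m]%2≡d (sym (m%n%n≡m%n (e + r) 2))))
  Nₙ%2≡n%2 : N n % 2 ≡ n % 2
  Nₙ%2≡n%2 = begin
    N n % 2         ≡⟨ cong (_% 2) Nₙ≡d+Nₘ ⟩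
    (d + N m) % 2   ≡⟨ +-cong-% 2 {d} {d} {N m} {r} refl Nₘ%2≡r%2 ⟩
    (d + r) % 2     ≡⟨ parity-step e≤1 (m%n<n (N m) 4) ⟩
    e % 2           ≡⟨ [e+2m]%2≡e%2 e m ⟨
    n % 2           ∎
  Mₙ%2≡χ[Nₙ%4] : M n % 2 ≡ isOneOrTwo (N n % 4)
  Mₙ%2≡χ[Nₙ%4] = begin
    M n % 2
      ≡⟨ cong (_% 2) Mₙ≡[e*[e+m]]%2+Mₘ ⟩
    ((e * (e + m)) % 2 + M m) % 2
      ≡⟨ +-cong-% 2 {(e * (e + m)) % 2} {e * d} {M m} {M m % 2}
                    [e*[e+m]]%2%2≡[e*d]%2 (sym (m%n%n≡m%n (M m) 2)) ⟩
    (e * d + M m % 2) % 2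
      ≡⟨ cong (λ y → (e * d + y) % 2) Mₘ%2≡χ[Nₘ%4] ⟩
    (e * d + isOneOrTwo r) % 2
      ≡⟨ isOneOrTwo-step e≤1 (m%n<n (N m) 4) ⟩
    isOneOrTwo ((d + r) % 4)
      ≡⟨ cong isOneOrTwo (+-cong-% 4 {d} {d} {r} {N m} refl (m%n%n≡m%n (N m) 4)) ⟩
    isOneOrTwo ((d + N m) % 4)
      ≡⟨ cong (λ x → isOneOrTwo (x % 4)) Nₙ≡d+Nₘ ⟨
    isOneOrTwo (N n % 4) ∎

oddCountInvariant : ∀ n → OddCountInvariant n
oddCountInvariant = binary-induction OddCountInvariant (refl , refl) oddCountInvariant-[e+2m]

[8j+4i+1]%16≡[i+2j]*4+1 : ∀ {i j} → i ≤ 1 → j ≤ 1 →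
                          (8 * j + 4 * i + 1) % 16 ≡ (i + 2 * j) * 4 + 1
[8j+4i+1]%16≡[i+2j]*4+1 z≤n       z≤n       = refl
[8j+4i+1]%16≡[i+2j]*4+1 z≤n       (s≤s z≤n) = refl
[8j+4i+1]%16≡[i+2j]*4+1 (s≤s z≤n) z≤n       = refl
[8j+4i+1]%16≡[i+2j]*4+1 (s≤s z≤n) (s≤s z≤n) = refl

isOneOrTwo[i+2j]*2+1≡[2[i+j]+1]%4 : ∀ {i j} → i ≤ 1 → j ≤ 1 →
                                    isOneOrTwo (i + 2 * j) * 2 + 1 ≡ (2 * (i + j) + 1) % 4
isOneOrTwo[i+2j]*2+1≡[2[i+j]+1]%4 z≤n       z≤n       = refl
isOneOrTwo[i+2j]*2+1≡[2[i+j]+1]%4 z≤n       (s≤s z≤n) = refl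
isOneOrTwo[i+2j]*2+1≡[2[i+j]+1]%4 (s≤s z≤n) z≤n       = refl
isOneOrTwo[i+2j]*2+1≡[2[i+j]+1]%4 (s≤s z≤n) (s≤s z≤n) = refl

theorem1p3 : (n i j : ℕ) → i ≤ 1 → j ≤ 1 →
    A n % 16 ≡ (8 * j + 4 * i + 1) % 16 →
    β n % 4 ≡ (2 * (i + j) + 1) % 4
theorem1p3 n i j i≤1 j≤1 A%16≡8j+4i+1 = begin
  β n % 4                                      ≡⟨ β%4≡oddCount%2*2+1 n ⟩
  oddCount βHalfTerm n % 2 * 2 + 1             ≡⟨ cong (λ b → b * 2 + 1) (proj₂ (oddCountInvariant n)) ⟩
  isOneOrTwo (oddCount halfTerm n % 4) * 2 + 1 ≡⟨ cong (λ r → isOneOrTwo r * 2 + 1) N%4≡i+2j ⟩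
  isOneOrTwo (i + 2 * j) * 2 + 1               ≡⟨ isOneOrTwo[i+2j]*2+1≡[2[i+j]+1]%4 i≤1 j≤1 ⟩
  (2 * (i + j) + 1) % 4                        ∎
  where
  open ≡-Reasoning
  N%4≡i+2j : oddCount halfTerm n % 4 ≡ i + 2 * j
  N%4≡i+2j = *-cancelʳ-≡ _ _ 4 (+-cancelʳ-≡ 1 _ _ (begin
    oddCount halfTerm n % 4 * 4 + 1 ≡⟨ A%16≡oddCount%4*4+1 n ⟨
    A n % 16                        ≡⟨ A%16≡8j+4i+1 ⟩
    (8 * j + 4 * i + 1) % 16        ≡⟨ [8j+4i+1]%16≡[i+2j]*4+1 i≤1 j≤1 ⟩
    (i + 2 * j) * 4 + 1             ∎))
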